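{- Let $X$ be a finite set, $\eta:X\to\mathbb{Z}$ a statistic, and $\phi,\psi:X\to X$ bijections. Suppose $\phi$ is homomesic with respect to $\eta$. Then every orbit $\mathcal{O}$ of $\psi$ that is $\phi$-closed (i.e. $\phi(x)\in\mathcal{O}$ for all $x\in\mathcal{O}$) is orbitmesic with respect to $\eta$.
   Context: A bijection $\phi$ on a finite set $X$ is homomesic with respect to $\eta$ if every $\phi$-orbit has the same average value of $\eta$ (equivalently, each orbit's average equals the global average $\frac{1}{|X|}\sum_{x\in X}\eta(x)$). An orbit $\mathcal{O}$ of a bijection is orbitmesic with respect to $\eta$ if $\frac{1}{|\mathcal{O}|}\sum_{x\in\mathcal{O}}\eta(x)=\frac{1}{|X|}\sum_{x\in X}\eta(x)$. -}

module Defs where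

open import Data.Nat using (ℕ; zero; suc)
open import Data.Fin using (Fin)
open import Data.Fin.Permutation using (Permutation′; _⟨$⟩ʳ_)
open import Data.Integer using (ℤ; +_; _*_; _+_)
open import Data.List using (List; []; _∷_; map; length; allFin)
open import Data.List.Membership.Propositional using (_∈_)
open import Data.List.Relation.Unary.Unique.Propositional using (Unique)
open import Data.Product using (∃; _×_)
open import Relation.Binary.PropositionalEquality using (_≡_)

iter : ∀ {n} → Permutation′ n → ℕ → Fin n → Fin n
iter σ zero    x = x
iter σ (suc k) x = σ ⟨$⟩ʳ iter σ k x

InOrbit : ∀ {n} → Permutation′ n → Fin n → Fin n → Set
InOrbit σ x y = ∃ λ k → iter σ k x ≡ y

IsOrbitList : ∀ {n} → Permutation′ n → Fin n → List (Fin n) → Set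
IsOrbitList σ x L = Unique L × (∀ y → (y ∈ L → InOrbit σ x y) × (InOrbit σ x y → y ∈ L))

sumℤ : List ℤ → ℤ
sumℤ []       = + 0
sumℤ (a ∷ as) = a + sumℤ as

total : ∀ {n} → (Fin n → ℤ) → ℤ
total {n} η = sumℤ (map η (allFin n))

-- an orbit (given as a list L) is orbitmesic w.r.t. η:
--   (1/|L|) Σ_{L} η = (1/|X|) Σ_X η, cleared of denominators
OrbitmesicList : ∀ {n} → (Fin n → ℤ) → List (Fin n) → Set
OrbitmesicList {n} η L = (+ n) * sumℤ (map η L) ≡ (+ length L) * total η

Homomesic : ∀ {n} → Permutation′ n → (Fin n → ℤ) → Set
Homomesic {n} φ η = ∀ (x : Fin n) (L : List (Fin n)) → IsOrbitList φ x L → OrbitmesicList η L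

PhiClosedOrbit : ∀ {n} → Permutation′ n → Permutation′ n → Fin n → Set
PhiClosedOrbit φ ψ x = ∀ y → InOrbit ψ x y → InOrbit ψ x (φ ⟨$⟩ʳ y)

{-# OPTIONS --safe #-}
module Submission where

open import Defs
open import Data.Nat using (ℕ)
open import Data.Fin using (Fin)
open import Data.Fin.Permutation using (Permutation′)
open import Data.Integer using (ℤ)
open import Data.List using (List)

open import Data.Fin using (toℕ; _≟_)
open import Data.Fin.Permutation using (_⟨$⟩ʳ_)
open import Data.Fin.Properties using (pigeonhole)
open import Data.Integer using (+_; _+_; _*_)
import Data.Integer.Properties as ℤ
open import Data.List using ([]; _∷_; _++_; map; length; allFin; filter; foldr)
open import Data.List.Properties using (map-++; length-++; filter-notAll; partition-defn)
open import Data.List.Membership.Propositional using (_∈_)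
open import Data.List.Membership.Propositional.Properties using (∈-filter⁺; ∈-filter⁻; ∈-allFin)
open import Data.List.Membership.Propositional.Properties.WithK using (unique∧set⇒bag)
open import Data.List.Relation.Binary.BagAndSetEquality using (∼bag⇒↭)
open import Data.List.Relation.Binary.Permutation.Propositional using (_↭_; ↭-sym; ↭ₛ⇒↭; ↭⇒↭ₛ)
open import Data.List.Relation.Binary.Permutation.Propositional.Properties using (↭-length; map⁺)
open import Data.List.Relation.Binary.Permutation.Setoid.Properties using (foldr-commMonoid; partition-↭)
open import Data.List.Relation.Unary.Any using (here)
open import Data.List.Relation.Unary.Unique.Propositional using (Unique)
open import Data.List.Relation.Unary.Unique.Propositional.Properties using (filter⁺; allFin⁺)
open import Data.Nat as ℕ using (zero; suc; _<_; _%_; _/_; _∸_)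
open import Data.Nat.DivMod using (m≡m%n+[m/n]*n; m%n<n)
open import Data.Nat.Induction using (<-wellFounded)
open import Data.Nat.Properties as ℕ using (anyUpTo?)
open import Data.Product using (∃; _,_; proj₁; proj₂)
open import Function using (_∘_; _⇔_; mk⇔; Injection)
open import Function.Properties.Inverse using (↔⇒↣)
open import Induction.WellFounded using (Acc; acc)
open import Level using (0ℓ)
open import Relation.Binary.PropositionalEquality
open import Relation.Nullary using (Dec)
open import Relation.Nullary.Decidable using (map′)
open import Relation.Unary as U using (Pred)
open import Relation.Unary.Properties using (∁?)

-- A φ-stable set is a disjoint union of φ-orbits, and the orbitmesy equation
-- n · Σ_O η = |O| · Σ_X η is additive over disjoint unions. Homomesy makes it hold on
-- each φ-orbit, hence on every φ-stable set, in particular on a φ-closed ψ-orbit.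

sumℤ-++ : ∀ xs ys → sumℤ (xs ++ ys) ≡ sumℤ xs + sumℤ ys
sumℤ-++ []       ys = sym (ℤ.+-identityˡ (sumℤ ys))
sumℤ-++ (x ∷ xs) ys = trans (cong (_+_ x) (sumℤ-++ xs ys)) (sym (ℤ.+-assoc x (sumℤ xs) (sumℤ ys)))

sumℤ≗foldr : ∀ xs → sumℤ xs ≡ foldr _+_ (+ 0) xs
sumℤ≗foldr []       = refl
sumℤ≗foldr (x ∷ xs) = cong (_+_ x) (sumℤ≗foldr xs)

sumℤ-↭ : ∀ {xs ys} → xs ↭ ys → sumℤ xs ≡ sumℤ ys
sumℤ-↭ {xs} {ys} p = begin
  sumℤ xs              ≡⟨ sumℤ≗foldr xs ⟩
  foldr _+_ (+ 0) xs   ≡⟨ foldr-commMonoid (setoid ℤ) ℤ.+-0-isCommutativeMonoid (↭⇒↭ₛ p) ⟩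
  foldr _+_ (+ 0) ys   ≡⟨ sumℤ≗foldr ys ⟨
  sumℤ ys              ∎
  where open ≡-Reasoning

module _ {A : Set} where

  ↭-filter-∁ : ∀ {P : Pred A 0ℓ} (P? : U.Decidable P) xs → xs ↭ filter P? xs ++ filter (∁? P?) xs
  ↭-filter-∁ P? xs = subst (λ (ys , zs) → xs ↭ ys ++ zs) (partition-defn P? xs)
                            (↭ₛ⇒↭ (partition-↭ (setoid A) P? xs))

  unique∧set⇒↭ : ∀ {xs ys : List A} → Unique xs → Unique ys → (∀ {z} → z ∈ xs ⇔ z ∈ ys) → xs ↭ ys
  unique∧set⇒↭ xs! ys! xs≈ys = ∼bag⇒↭ (unique∧set⇒bag xs! ys! xs≈ys)

module _ {n : ℕ} (σ : Permutation′ n) where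

  iter-+ : ∀ a b x → iter σ (a ℕ.+ b) x ≡ iter σ a (iter σ b x)
  iter-+ zero    b x = refl
  iter-+ (suc a) b x = cong (σ ⟨$⟩ʳ_) (iter-+ a b x)

  ⟨$⟩ʳ-injective : ∀ {x y} → σ ⟨$⟩ʳ x ≡ σ ⟨$⟩ʳ y → x ≡ y
  ⟨$⟩ʳ-injective = Injection.injective (↔⇒↣ σ)

  iter-injective : ∀ k {x y} → iter σ k x ≡ iter σ k y → x ≡ y
  iter-injective zero    eq = eq
  iter-injective (suc k) eq = iter-injective k (⟨$⟩ʳ-injective eq)

  iter-periodic : ∀ x → ∃ λ d → iter σ (suc d) x ≡ x
  iter-periodic x
    with i , j , i<j , σⁱx≡σʲx ← pigeonhole (ℕ.n<1+n n) (λ (i : Fin (suc n)) → iter σ (toℕ i) x)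
    = d , iter-injective (toℕ i) (begin
      iter σ (toℕ i) (iter σ (suc d) x)  ≡⟨ iter-+ (toℕ i) (suc d) x ⟨
      iter σ (toℕ i ℕ.+ suc d) x         ≡⟨ cong (λ k → iter σ k x) i+1+d≡j ⟩
      iter σ (toℕ j) x                   ≡⟨ σⁱx≡σʲx ⟨
      iter σ (toℕ i) x                   ∎)
    where
    open ≡-Reasoning
    d = toℕ j ∸ suc (toℕ i)
    i+1+d≡j : toℕ i ℕ.+ suc d ≡ toℕ j
    i+1+d≡j = trans (ℕ.+-suc (toℕ i) d) (ℕ.m+[n∸m]≡n i<j)

  module _ {x : Fin n} (d : ℕ) (σᵈ⁺¹x≡x : iter σ (suc d) x ≡ x) where

    iter-*-period : ∀ q → iter σ (q ℕ.* suc d) x ≡ x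
    iter-*-period zero    = refl
    iter-*-period (suc q) = begin
      iter σ (suc d ℕ.+ q ℕ.* suc d) x         ≡⟨ iter-+ (suc d) (q ℕ.* suc d) x ⟩
      iter σ (suc d) (iter σ (q ℕ.* suc d) x)  ≡⟨ cong (iter σ (suc d)) (iter-*-period q) ⟩
      iter σ (suc d) x                         ≡⟨ σᵈ⁺¹x≡x ⟩
      x                                        ∎
      where open ≡-Reasoning

    iter-% : ∀ k → iter σ k x ≡ iter σ (k % suc d) x
    iter-% k = begin
      iter σ k x                                             ≡⟨ cong (λ m → iter σ m x) (m≡m%n+[m/n]*n k (suc d)) ⟩
      iter σ (k % suc d ℕ.+ k / suc d ℕ.* suc d) x           ≡⟨ iter-+ (k % suc d) (k / suc d ℕ.* suc d) x ⟩
      iter σ (k % suc d) (iter σ (k / suc d ℕ.* suc d) x)    ≡⟨ cong (iter σ (k % suc d)) (iter-*-period (k / suc d)) ⟩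
      iter σ (k % suc d) x                                   ∎
      where open ≡-Reasoning

  inOrbit? : ∀ x y → Dec (InOrbit σ x y)
  inOrbit? x y with d , σᵈ⁺¹x≡x ← iter-periodic x =
    map′ (λ (k , _ , σᵏx≡y) → k , σᵏx≡y)
         (λ (k , σᵏx≡y) → k % suc d , m%n<n k (suc d) , trans (sym (iter-% d σᵈ⁺¹x≡x k)) σᵏx≡y)
         (anyUpTo? (λ k → iter σ k x ≟ y) (suc d))

  inOrbit-⟨$⟩ʳ⁻ : ∀ {x y} → InOrbit σ x (σ ⟨$⟩ʳ y) → InOrbit σ x y
  inOrbit-⟨$⟩ʳ⁻ {x} {y} (k , σᵏx≡σy) with d , σᵈ⁺¹x≡x ← iter-periodic x =
    k ℕ.+ d , ⟨$⟩ʳ-injective (begin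
      iter σ (suc (k ℕ.+ d)) x     ≡⟨ cong (λ m → iter σ m x) (ℕ.+-suc k d) ⟨
      iter σ (k ℕ.+ suc d) x       ≡⟨ iter-+ k (suc d) x ⟩
      iter σ k (iter σ (suc d) x)  ≡⟨ cong (iter σ k) σᵈ⁺¹x≡x ⟩
      iter σ k x                   ≡⟨ σᵏx≡σy ⟩
      σ ⟨$⟩ʳ y                     ∎)
    where open ≡-Reasoning

  orbit : Fin n → List (Fin n)
  orbit x = filter (inOrbit? x) (allFin n)

  orbit-isOrbitList : ∀ x → IsOrbitList σ x (orbit x)
  orbit-isOrbitList x =
    filter⁺ (inOrbit? x) (allFin⁺ n) ,
    λ y → proj₂ ∘ ∈-filter⁻ (inOrbit? x) {xs = allFin n} , ∈-filter⁺ (inOrbit? x) (∈-allFin y)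

module _ {n : ℕ} (η : Fin n → ℤ) where

  orbitmesic-[] : OrbitmesicList η []
  orbitmesic-[] = ℤ.*-zeroʳ (+ n)

  orbitmesic-++ : ∀ xs ys → OrbitmesicList η xs → OrbitmesicList η ys → OrbitmesicList η (xs ++ ys)
  orbitmesic-++ xs ys xs-orbitmesic ys-orbitmesic = begin
    + n * sumℤ (map η (xs ++ ys))        ≡⟨ cong (λ s → + n * sumℤ s) (map-++ η xs ys) ⟩
    + n * sumℤ (map η xs ++ map η ys)    ≡⟨ cong (λ s → + n * s) (sumℤ-++ (map η xs) (map η ys)) ⟩
    + n * (Σxs + Σys)                    ≡⟨ ℤ.*-distribˡ-+ (+ n) Σxs Σys ⟩
    + n * Σxs + + n * Σys                ≡⟨ cong₂ _+_ xs-orbitmesic ys-orbitmesic ⟩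
    + length xs * T + + length ys * T    ≡⟨ ℤ.*-distribʳ-+ T (+ length xs) (+ length ys) ⟨
    (+ length xs + + length ys) * T      ≡⟨ cong (_* T) (ℤ.pos-+ (length xs) (length ys)) ⟨
    + (length xs ℕ.+ length ys) * T      ≡⟨ cong (λ l → + l * T) (length-++ xs) ⟨
    + length (xs ++ ys) * T              ∎
    where
    open ≡-Reasoning
    Σxs = sumℤ (map η xs)
    Σys = sumℤ (map η ys)
    T = total η

  orbitmesic-↭ : ∀ {xs ys} → xs ↭ ys → OrbitmesicList η xs → OrbitmesicList η ys
  orbitmesic-↭ xs↭ys = subst₂ (λ s l → + n * s ≡ + l * total η) (sumℤ-↭ (map⁺ η xs↭ys)) (↭-length xs↭ys)

Stable : ∀ {n} → Permutation′ n → List (Fin n) → Set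
Stable φ L = ∀ {z} → z ∈ L → φ ⟨$⟩ʳ z ∈ L

module _ {n : ℕ} (φ : Permutation′ n) {L : List (Fin n)} (L-stable : Stable φ L) where

  stable-iter : ∀ {x} → x ∈ L → ∀ k → iter φ k x ∈ L
  stable-iter x∈L zero    = x∈L
  stable-iter x∈L (suc k) = L-stable (stable-iter x∈L k)

  filter-inOrbit-↭-orbit : Unique L → ∀ {x} → x ∈ L → filter (inOrbit? φ x) L ↭ orbit φ x
  filter-inOrbit-↭-orbit L! {x} x∈L =
    unique∧set⇒↭ (filter⁺ (inOrbit? φ x) L!) (proj₁ (orbit-isOrbitList φ x)) (mk⇔ to from)
    where
    to : ∀ {y} → y ∈ filter (inOrbit? φ x) L → y ∈ orbit φ x
    to {y} = ∈-filter⁺ (inOrbit? φ x) (∈-allFin y) ∘ proj₂ ∘ ∈-filter⁻ (inOrbit? φ x) {xs = L}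
    from : ∀ {y} → y ∈ orbit φ x → y ∈ filter (inOrbit? φ x) L
    from {y} y∈orbit with k , φᵏx≡y ← proj₂ (∈-filter⁻ (inOrbit? φ x) {xs = allFin n} y∈orbit) =
      ∈-filter⁺ (inOrbit? φ x) (subst (_∈ L) φᵏx≡y (stable-iter x∈L k)) (k , φᵏx≡y)

  stable-filter-∉orbit : ∀ x → Stable φ (filter (∁? (inOrbit? φ x)) L)
  stable-filter-∉orbit x z∈rest with z∈L , z∉orbit ← ∈-filter⁻ (∁? (inOrbit? φ x)) z∈rest =
    ∈-filter⁺ (∁? (inOrbit? φ x)) (L-stable z∈L) (z∉orbit ∘ inOrbit-⟨$⟩ʳ⁻ φ)

module _ {n : ℕ} (φ : Permutation′ n) (η : Fin n → ℤ) (homomesic : Homomesic φ η) where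

  unique∧stable⇒orbitmesic : ∀ {L} → Unique L → Stable φ L → OrbitmesicList η L
  unique∧stable⇒orbitmesic = go (<-wellFounded _)
    where
    go : ∀ {L} → Acc _<_ (length L) → Unique L → Stable φ L → OrbitmesicList η L
    go {[]}         _         _  _        = orbitmesic-[] η
    go {L@(x ∷ _)} (acc rec) L! L-stable =
      orbitmesic-↭ η (↭-sym (↭-filter-∁ P? L))
        (orbitmesic-++ η (filter P? L) (filter (∁? P?) L) orbit-part rest-part)
      where
      P? : U.Decidable (InOrbit φ x)
      P? = inOrbit? φ x
      orbit-part : OrbitmesicList η (filter P? L)
      orbit-part = orbitmesic-↭ η (↭-sym (filter-inOrbit-↭-orbit φ L-stable L! (here refl)))
                                  (homomesic x (orbit φ x) (orbit-isOrbitList φ x))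
      rest-part : OrbitmesicList η (filter (∁? P?) L)
      rest-part = go (rec (filter-notAll (∁? P?) L (here λ x∉orbit → x∉orbit (0 , refl))))
                     (filter⁺ (∁? P?) L!) (stable-filter-∉orbit φ L-stable x)

proposition2p3 : (n : ℕ) (η : Fin n → ℤ) (φ ψ : Permutation′ n) → Homomesic φ η → (x : Fin n) → PhiClosedOrbit φ ψ x → (L : List (Fin n)) → IsOrbitList ψ x L → OrbitmesicList η L
proposition2p3 n η φ ψ homomesic x closed L (L! , L-members) =
  unique∧stable⇒orbitmesic φ η homomesic L! L-stable
  where
  L-stable : Stable φ L
  L-stable z∈L = proj₂ (L-members _) (closed _ (proj₁ (L-members _) z∈L))
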